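{- Let $c\neq 0$ be a rational number and let $b=0$. Then the cubic polynomials $P(x)$ and $Q(d)$ (defined in the context) are reducible over $\mathbb{Q}$. Moreover, each of $P$ and $Q$ has three integer roots (counted with multiplicity), and these roots can be labelled $x_1,x_2,x_3$ (roots of $P$) and $d_1,d_2,d_3$ (roots of $Q$) so that the auxiliary equations hold; however, these six numbers are not all positive, so they do not provide a solution of the perfect cuboid problem (Problem 1.2).
   Context: Let $b,c$ be rational numbers. Put $\Delta=b^2c^4-6b^2c^3+13b^2c^2-12b^2c+4b^2+c^2$ and $N=(bc-1-b)(bc-c-2b)$, and assume $\Delta\,N\neq 0$, so that all the following rational numbers are defined (with $D=b^2c^2+2b^2-3b^2c+c-bc^2+2b$): $E_{11}=-\frac{b(c^2+2-4c)}{D}$, $E_{01}=-\frac{b(c^2+2-2c)}{D}$, $E_{10}=-\frac{b^2c^2+2b^2-3b^2c-c}{D}$; $E_{20}=\frac{b}{2}(bc^2-2c-2b)(2bc^2-c^2-6bc+2+4b)(bc-1-b)^{ -2}(bc-c-2b)^{ -2}$; $E_{02}=\frac12(28b^2c^2-16b^2c-2c^2-4b^2-b^2c^4+4b^3c^4-12b^3c^3+4bc^3+24b^3c-8bc-2b^4c^4+12b^4c^3-26b^4c^2-8b^2c^3+24b^4c-16b^3-8b^4)(bc-1-b)^{ -2}(bc-c-2b)^{ -2}$; $E_{21}=\frac{b}{2}(5c^6b-2c^6b^2+52c^5b^2-16c^5b-2c^7b^2+2b^4c^8+142b^4c^6-26b^4c^7-426b^4c^5-61b^3c^6+100b^3c^5+14c^7b^3-c^8b^3-20bc^2-8b^2c^2-16b^2c-128b^2c^4-200b^3c^3+244b^3c^2+32bc^3-112b^3c+768b^4c^4-852b^4c^3+568b^4c^2+104b^2c^3-208b^4c+8c^4-4c^3+16b^3+32b^4-2c^5)\,\Delta^{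 -1}(bc-1-b)^{ -2}(bc-c-2b)^{ -2}$; $E_{12}=(16b^6+32b^5-6c^5b^2+2c^5b-62b^5c^6+62b^6c^6-180b^6c^5+18b^5c^7-12b^6c^7-2b^5c^8+b^6c^8+248b^5c^2+248b^6c^2-96b^6c+321b^6c^4-180b^5c^3-144b^5c-360b^6c^3+b^4c^8+8b^4c^6-6b^4c^7+18b^4c^5+7b^3c^6+90b^5c^5-14b^3c^5-c^7b^3+17b^2c^4+28b^3c^3-28b^3c^2-4bc^3+8b^3c-57b^4c^4+36b^4c^3+32b^4c^2-12b^2c^3-48b^4c-c^4+16b^4)\,\Delta^{ -1}(bc-1-b)^{ -2}(bc-c-2b)^{ -2}$; $E_{03}=\frac{b}{2}(b^2c^4-5b^2c^3+10b^2c^2-10b^2c+4b^2+2bc+2c^2-bc^3)(2b^2c^4-12b^2c^3+26b^2c^2-24b^2c+8b^2-c^4b+3bc^3-6bc+4b+c^3-2c^2+2c)\,\Delta^{ -1}(bc-1-b)^{ -2}(bc-c-2b)^{ -2}$; $E_{30}=c\,b^2(1-c)(c-2)(bc^2-4bc+2+4b)(2bc^2-c^2-4bc+2b)\,\Delta^{ -1}(bc-1-b)^{ -2}(bc-c-2b)^{ -2}$. Define $P(x)=x^3-E_{10}x^2+E_{20}x-E_{30}$ and $Q(d)=d^3-E_{01}d^2+E_{02}d-E_{03}$. For numbers $x_1,x_2,x_3,d_1,d_2,d_3$ the auxiliary equations are: $x_1x_2d_3+x_2x_3d_1+x_3x_1d_2=E_{21}$, $x_1d_2+d_1x_2+x_2d_3+d_2x_3+x_3d_1+d_3x_1=E_{11}$,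 $x_1d_2d_3+x_2d_3d_1+x_3d_1d_2=E_{12}$. Problem 1.2 (equivalent to finding a perfect cuboid) asks for rational $b,c$ such that $P$ and $Q$ have positive rational roots $x_1,x_2,x_3$ and $d_1,d_2,d_3$ satisfying the auxiliary equations. -}

module Defs where

open import Data.Nat using (ℕ; zero; suc)
open import Data.Integer using (+_)
open import Data.Rational using (ℚ; 0ℚ; 1ℚ; _+_; _*_; _-_; -_; 1/_; _/_; _≟_; ≢-nonZero; _>_)
open import Data.List using (List; []; _∷_; foldr; length; last)
open import Data.Maybe using (just)
open import Data.Product using (Σ; ∃; _×_; _,_)
open import Relation.Nullary using (¬_; yes; no)
open import Relation.Binary.PropositionalEquality using (_≡_; _≢_)

k : ℕ → ℚ
k n = + n / 1

½ : ℚ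
½ = + 1 / 2

infixr 8 _^_
_^_ : ℚ → ℕ → ℚ
q ^ zero  = 1ℚ
q ^ suc n = q * q ^ n

-- Total inverse: inv q = 1/q for q ≠ 0 (and 0 for q = 0; this value is
-- never used under the standing assumption Δ·N ≠ 0).
inv : ℚ → ℚ
inv q with q ≟ 0ℚ
... | yes _  = 0ℚ
... | no q≢0 = 1/_ q {{≢-nonZero q≢0}}

Σℚ : List ℚ → ℚ
Σℚ = foldr _+_ 0ℚ

module _ (b c : ℚ) where

  t : ℚ → ℕ → ℕ → ℚ
  t a i j = a * b ^ i * c ^ j

  Δ : ℚ
  Δ = Σℚ (t 1ℚ 2 4 ∷ t (- k 6) 2 3 ∷ t (k 13) 2 2 ∷ t (- k 12) 2 1 ∷ t (k 4) 2 0 ∷ t 1ℚ 0 2 ∷ [])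

  N₁ N₂ N : ℚ
  N₁ = b * c - 1ℚ - b
  N₂ = b * c - c - k 2 * b
  N  = N₁ * N₂

  D : ℚ
  D = Σℚ (t 1ℚ 2 2 ∷ t (k 2) 2 0 ∷ t (- k 3) 2 1 ∷ t 1ℚ 0 1 ∷ t (- 1ℚ) 1 2 ∷ t (k 2) 1 0 ∷ [])

  invN² : ℚ
  invN² = inv (N₁ ^ 2 * N₂ ^ 2)

  E11 E01 E10 : ℚ
  E11 = - (b * (c ^ 2 + k 2 - k 4 * c)) * inv D
  E01 = - (b * (c ^ 2 + k 2 - k 2 * c)) * inv D
  E10 = - (Σℚ (t 1ℚ 2 2 ∷ t (k 2) 2 0 ∷ t (- k 3) 2 1 ∷ t (- 1ℚ) 0 1 ∷ [])) * inv D

  E20 : ℚ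
  E20 = ½ * b * (b * c ^ 2 - k 2 * c - k 2 * b)
          * (k 2 * b * c ^ 2 - c ^ 2 - k 6 * b * c + k 2 + k 4 * b) * invN²

  E02 : ℚ
  E02 = ½ * Σℚ (t (k 28) 2 2 ∷ t (- k 16) 2 1 ∷ t (- k 2) 0 2 ∷ t (- k 4) 2 0
              ∷ t (- 1ℚ) 2 4 ∷ t (k 4) 3 4 ∷ t (- k 12) 3 3 ∷ t (k 4) 1 3
              ∷ t (k 24) 3 1 ∷ t (- k 8) 1 1 ∷ t (- k 2) 4 4 ∷ t (k 12) 4 3
              ∷ t (- k 26) 4 2 ∷ t (- k 8) 2 3 ∷ t (k 24) 4 1 ∷ t (- k 16) 3 0
              ∷ t (- k 8) 4 0 ∷ [])
          * invN²

  E21 : ℚ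
  E21 = ½ * b * Σℚ (t (k 5) 1 6 ∷ t (- k 2) 2 6 ∷ t (k 52) 2 5 ∷ t (- k 16) 1 5
                  ∷ t (- k 2) 2 7 ∷ t (k 2) 4 8 ∷ t (k 142) 4 6 ∷ t (- k 26) 4 7
                  ∷ t (- k 426) 4 5 ∷ t (- k 61) 3 6 ∷ t (k 100) 3 5 ∷ t (k 14) 3 7
                  ∷ t (- 1ℚ) 3 8 ∷ t (- k 20) 1 2 ∷ t (- k 8) 2 2 ∷ t (- k 16) 2 1
                  ∷ t (- k 128) 2 4 ∷ t (- k 200) 3 3 ∷ t (k 244) 3 2 ∷ t (k 32) 1 3
                  ∷ t (- k 112) 3 1 ∷ t (k 768) 4 4 ∷ t (- k 852) 4 3 ∷ t (k 568) 4 2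
                  ∷ t (k 104) 2 3 ∷ t (- k 208) 4 1 ∷ t (k 8) 0 4 ∷ t (- k 4) 0 3
                  ∷ t (k 16) 3 0 ∷ t (k 32) 4 0 ∷ t (- k 2) 0 5 ∷ [])
          * inv Δ * invN²

  E12 : ℚ
  E12 = Σℚ (t (k 16) 6 0 ∷ t (k 32) 5 0 ∷ t (- k 6) 2 5 ∷ t (k 2) 1 5
          ∷ t (- k 62) 5 6 ∷ t (k 62) 6 6 ∷ t (- k 180) 6 5 ∷ t (k 18) 5 7
          ∷ t (- k 12) 6 7 ∷ t (- k 2) 5 8 ∷ t 1ℚ 6 8 ∷ t (k 248) 5 2
          ∷ t (k 248) 6 2 ∷ t (- k 96) 6 1 ∷ t (k 321) 6 4 ∷ t (- k 180) 5 3
          ∷ t (- k 144) 5 1 ∷ t (- k 360) 6 3 ∷ t 1ℚ 4 8 ∷ t (k 8) 4 6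
          ∷ t (- k 6) 4 7 ∷ t (k 18) 4 5 ∷ t (k 7) 3 6 ∷ t (k 90) 5 5
          ∷ t (- k 14) 3 5 ∷ t (- 1ℚ) 3 7 ∷ t (k 17) 2 4 ∷ t (k 28) 3 3
          ∷ t (- k 28) 3 2 ∷ t (- k 4) 1 3 ∷ t (k 8) 3 1 ∷ t (- k 57) 4 4
          ∷ t (k 36) 4 3 ∷ t (k 32) 4 2 ∷ t (- k 12) 2 3 ∷ t (- k 48) 4 1
          ∷ t (- 1ℚ) 0 4 ∷ t (k 16) 4 0 ∷ [])
        * inv Δ * invN²

  E03 : ℚ
  E03 = ½ * b
          * Σℚ (t 1ℚ 2 4 ∷ t (- k 5) 2 3 ∷ t (k 10) 2 2 ∷ t (- k 10) 2 1 ∷ t (k 4) 2 0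
              ∷ t (k 2) 1 1 ∷ t (k 2) 0 2 ∷ t (- 1ℚ) 1 3 ∷ [])
          * Σℚ (t (k 2) 2 4 ∷ t (- k 12) 2 3 ∷ t (k 26) 2 2 ∷ t (- k 24) 2 1 ∷ t (k 8) 2 0
              ∷ t (- 1ℚ) 1 4 ∷ t (k 3) 1 3 ∷ t (- k 6) 1 1 ∷ t (k 4) 1 0 ∷ t 1ℚ 0 3
              ∷ t (- k 2) 0 2 ∷ t (k 2) 0 1 ∷ [])
          * inv Δ * invN²

  E30 : ℚ
  E30 = c * b ^ 2 * (1ℚ - c) * (c - k 2)
          * (b * c ^ 2 - k 4 * b * c + k 2 + k 4 * b)
          * (k 2 * b * c ^ 2 - c ^ 2 - k 4 * b * c + k 2 * b)
          * inv Δ * invN²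

-- Univariate polynomials over ℚ as coefficient lists [a₀, a₁, …, aₙ]

Poly : Set
Poly = List ℚ

eval : Poly → ℚ → ℚ
eval []       x = 0ℚ
eval (a ∷ as) x = a + x * eval as x

HasDegree : Poly → ℕ → Set
HasDegree f n = length f ≡ suc n × Σ ℚ (λ a → last f ≡ just a × a ≢ 0ℚ)

-- f is reducible over ℚ: f = g·h with g, h of positive degree
-- (equality of polynomials over the infinite field ℚ, checked pointwise)
Reducible : Poly → Set
Reducible f = Σ Poly λ g → Σ Poly λ h → Σ ℕ λ m → Σ ℕ λ n →
  HasDegree g (suc m) × HasDegree h (suc n) × (∀ x → eval g x * eval h x ≡ eval f x)

P Q : ℚ → ℚ → Poly
P b c = - E30 b c ∷ E20 b c ∷ - E10 b c ∷ 1ℚ ∷ []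
Q b c = - E03 b c ∷ E02 b c ∷ - E01 b c ∷ 1ℚ ∷ []

RootsOf : Poly → ℚ → ℚ → ℚ → Set
RootsOf f r₁ r₂ r₃ = ∀ x → eval f x ≡ (x - r₁) * (x - r₂) * (x - r₃)

Auxiliary : ℚ → ℚ → ℚ → ℚ → ℚ → ℚ → ℚ → ℚ → Set
Auxiliary b c x₁ x₂ x₃ d₁ d₂ d₃ =
    (x₁ * x₂ * d₃ + x₂ * x₃ * d₁ + x₃ * x₁ * d₂ ≡ E21 b c)
  × (x₁ * d₂ + d₁ * x₂ + x₂ * d₃ + d₂ * x₃ + x₃ * d₁ + d₃ * x₁ ≡ E11 b c)
  × (x₁ * d₂ * d₃ + x₂ * d₃ * d₁ + x₃ * d₁ * d₂ ≡ E12 b c)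

AllPositive : ℚ → ℚ → ℚ → ℚ → ℚ → ℚ → Set
AllPositive x₁ x₂ x₃ d₁ d₂ d₃ =
  x₁ > 0ℚ × x₂ > 0ℚ × x₃ > 0ℚ × d₁ > 0ℚ × d₂ > 0ℚ × d₃ > 0ℚ

SolvesProblem12 : ℚ → ℚ → Set
SolvesProblem12 b c = Σ ℚ λ x₁ → Σ ℚ λ x₂ → Σ ℚ λ x₃ → Σ ℚ λ d₁ → Σ ℚ λ d₂ → Σ ℚ λ d₃ →
  RootsOf (P b c) x₁ x₂ x₃ × RootsOf (Q b c) d₁ d₂ d₃
  × Auxiliary b c x₁ x₂ x₃ d₁ d₂ d₃ × AllPositive x₁ x₂ x₃ d₁ d₂ d₃

-- At b = 0 every coefficient with a factor b vanishes, while D, Δ and N₁²N₂² collapse to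
-- c, c² and c², leaving E10 = 1 and E02 = E12 = -1.  Hence P = x²(x - 1) and
-- Q = d(d - 1)(d + 1) split over ℤ, and with x = (0, 0, 1), d = (1, -1, 0) the auxiliary
-- equations read 0 = 0, 0 = 0, -1 = -1.  No labelling of the roots is positive, because
-- P(0) = 0 forces x₁x₂x₃ = 0.
{-# OPTIONS --safe #-}
module Submission where

open import Defs
open import Data.Integer using (ℤ; +_; -[1+_])
open import Data.Rational using (ℚ; 0ℚ; 1ℚ; _/_; _+_; _*_; _-_; -_; _>_; _≟_; ≢-nonZero)
open import Data.Rational.Properties
  using ( *-comm; *-assoc; *-identityˡ; *-identityʳ; *-zeroˡ; *-zeroʳ; +-identityˡ; *-inverseʳ
        ; <⇒≢; <-irrefl; neg-injective)
open import Data.Rational.Solver using (module +-*-Solver)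
open import Data.List using (List; []; _∷_; map)
open import Data.Nat using (ℕ; zero; suc)
open import Data.Empty using (⊥)
open import Data.Product using (Σ; _×_; _,_)
open import Relation.Nullary using (¬_; yes; no; contradiction)
open import Relation.Binary.PropositionalEquality
  using (_≡_; _≢_; refl; sym; trans; cong; cong₂; subst; ≢-sym; module ≡-Reasoning)

open +-*-Solver
open ≡-Reasoning

*-inv : ∀ {q} → q ≢ 0ℚ → q * inv q ≡ 1ℚ
*-inv {q} q≢0 with q ≟ 0ℚ
... | yes q≡0 = contradiction q≡0 q≢0
... | no q≢0′ = *-inverseʳ q {{≢-nonZero q≢0′}}

*-≢0 : ∀ {p q} → p ≢ 0ℚ → q ≢ 0ℚ → p * q ≢ 0ℚ
*-≢0 {p} {q} p≢0 q≢0 pq≡0 = q≢0 (begin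
  q               ≡⟨ sym (*-identityˡ q) ⟩
  1ℚ * q          ≡⟨ cong (_* q) (trans (*-comm (inv p) p) (*-inv p≢0)) ⟨
  inv p * p * q   ≡⟨ *-assoc (inv p) p q ⟩
  inv p * (p * q) ≡⟨ cong (inv p *_) pq≡0 ⟩
  inv p * 0ℚ      ≡⟨ *-zeroʳ (inv p) ⟩
  0ℚ              ∎)

p≡0⇒p*q≡0 : ∀ {p q} → p ≡ 0ℚ → p * q ≡ 0ℚ
p≡0⇒p*q≡0 {q = q} refl = *-zeroˡ q

>0⇒≢0 : ∀ {q} → q > 0ℚ → q ≢ 0ℚ
>0⇒≢0 q>0 = ≢-sym (<⇒≢ q>0)

module _ {f : Poly} {r₁ r₂ r₃ : ℚ} (roots : RootsOf f r₁ r₂ r₃) where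

  roots⇒reducible : Reducible f
  roots⇒reducible =
    g , h , 0 , 1 , (refl , 1ℚ , refl , λ ()) , (refl , 1ℚ , refl , λ ()) , factorisation
    where
    g h : Poly
    g = - r₁ ∷ 1ℚ ∷ []
    h = r₂ * r₃ ∷ - (r₂ + r₃) ∷ 1ℚ ∷ []

    factorisation : ∀ x → eval g x * eval h x ≡ eval f x
    factorisation x = trans
      (solve 4 (λ r₁ r₂ r₃ x →
           (:- r₁ :+ x :* (con 1ℚ :+ x :* con 0ℚ))
        :* (r₂ :* r₃ :+ x :* (:- (r₂ :+ r₃) :+ x :* (con 1ℚ :+ x :* con 0ℚ)))
        := (x :- r₁) :* (x :- r₂) :* (x :- r₃)) refl r₁ r₂ r₃ x)
      (sym (roots x))

  eval-0≡0⇒¬positive-roots : eval f 0ℚ ≡ 0ℚ → r₁ > 0ℚ → r₂ > 0ℚ → r₃ > 0ℚ → ⊥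
  eval-0≡0⇒¬positive-roots f[0]≡0 r₁>0 r₂>0 r₃>0 =
    *-≢0 (*-≢0 (>0⇒≢0 r₁>0) (>0⇒≢0 r₂>0)) (>0⇒≢0 r₃>0) (neg-injective (begin
      - (r₁ * r₂ * r₃)
        ≡⟨ solve 3 (λ r₁ r₂ r₃ → :- (r₁ :* r₂ :* r₃)
                                := (con 0ℚ :- r₁) :* (con 0ℚ :- r₂) :* (con 0ℚ :- r₃)) refl r₁ r₂ r₃ ⟩
      (0ℚ - r₁) * (0ℚ - r₂) * (0ℚ - r₃)
        ≡⟨ roots 0ℚ ⟨
      eval f 0ℚ
        ≡⟨ f[0]≡0 ⟩
      0ℚ
        ∎))

x³-x²-roots : RootsOf (0ℚ ∷ 0ℚ ∷ - 1ℚ ∷ 1ℚ ∷ []) 0ℚ 0ℚ 1ℚ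
x³-x²-roots = solve 1 (λ x →
     con 0ℚ :+ x :* (con 0ℚ :+ x :* (con (- 1ℚ) :+ x :* (con 1ℚ :+ x :* con 0ℚ)))
  := (x :- con 0ℚ) :* (x :- con 0ℚ) :* (x :- con 1ℚ)) refl

x³-x-roots : RootsOf (0ℚ ∷ - 1ℚ ∷ 0ℚ ∷ 1ℚ ∷ []) 1ℚ (- 1ℚ) 0ℚ
x³-x-roots = solve 1 (λ x →
     con 0ℚ :+ x :* (con (- 1ℚ) :+ x :* (con 0ℚ :+ x :* (con 1ℚ :+ x :* con 0ℚ)))
  := (x :- con 1ℚ) :* (x :- con (- 1ℚ)) :* (x :- con 0ℚ)) refl

Monomial : Set
Monomial = ℚ × ℕ × ℕ

monomial : ℚ → ℚ → Monomial → ℚ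
monomial b c (a , i , j) = t b c a i j

sumMonomials : ℚ → ℚ → List Monomial → ℚ
sumMonomials b c ms = Σℚ (map (monomial b c) ms)

bFreePart : List Monomial → ℚ → ℚ
bFreePart []                    c = 0ℚ
bFreePart ((a , zero  , j) ∷ ms) c = a * c ^ j + bFreePart ms c
bFreePart ((a , suc i , j) ∷ ms) c = bFreePart ms c

sumMonomials-at-b≡0 : ∀ c ms → sumMonomials 0ℚ c ms ≡ bFreePart ms c
sumMonomials-at-b≡0 c [] = refl
sumMonomials-at-b≡0 c ((a , zero , j) ∷ ms) =
  cong₂ _+_ (cong (_* c ^ j) (*-identityʳ a)) (sumMonomials-at-b≡0 c ms)
sumMonomials-at-b≡0 c ((a , suc i , j) ∷ ms) = begin
  a * (0ℚ * 0ℚ ^ i) * c ^ j + sumMonomials 0ℚ c ms ≡⟨ cong (_+ sumMonomials 0ℚ c ms) monomial≡0 ⟩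
  0ℚ + sumMonomials 0ℚ c ms                        ≡⟨ +-identityˡ _ ⟩
  sumMonomials 0ℚ c ms                             ≡⟨ sumMonomials-at-b≡0 c ms ⟩
  bFreePart ms c                                   ∎
  where
  monomial≡0 : a * (0ℚ * 0ℚ ^ i) * c ^ j ≡ 0ℚ
  monomial≡0 = p≡0⇒p*q≡0 (trans (cong (a *_) (*-zeroˡ (0ℚ ^ i))) (*-zeroʳ a))

-- Transcriptions of the monomial lists in Defs: e.g. D b c is definitionally
-- sumMonomials b c D-monomials.
D-monomials Δ-monomials E10-monomials E02-monomials E12-monomials : List Monomial
D-monomials =
  (1ℚ , 2 , 2) ∷ (k 2 , 2 , 0) ∷ (- k 3 , 2 , 1) ∷ (1ℚ , 0 , 1) ∷ (- 1ℚ , 1 , 2)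
  ∷ (k 2 , 1 , 0) ∷ []
Δ-monomials =
  (1ℚ , 2 , 4) ∷ (- k 6 , 2 , 3) ∷ (k 13 , 2 , 2) ∷ (- k 12 , 2 , 1) ∷ (k 4 , 2 , 0)
  ∷ (1ℚ , 0 , 2) ∷ []
E10-monomials =
  (1ℚ , 2 , 2) ∷ (k 2 , 2 , 0) ∷ (- k 3 , 2 , 1) ∷ (- 1ℚ , 0 , 1) ∷ []
E02-monomials =
  (k 28 , 2 , 2) ∷ (- k 16 , 2 , 1) ∷ (- k 2 , 0 , 2) ∷ (- k 4 , 2 , 0) ∷ (- 1ℚ , 2 , 4)
  ∷ (k 4 , 3 , 4) ∷ (- k 12 , 3 , 3) ∷ (k 4 , 1 , 3) ∷ (k 24 , 3 , 1) ∷ (- k 8 , 1 , 1)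
  ∷ (- k 2 , 4 , 4) ∷ (k 12 , 4 , 3) ∷ (- k 26 , 4 , 2) ∷ (- k 8 , 2 , 3) ∷ (k 24 , 4 , 1)
  ∷ (- k 16 , 3 , 0) ∷ (- k 8 , 4 , 0) ∷ []
E12-monomials =
  (k 16 , 6 , 0) ∷ (k 32 , 5 , 0) ∷ (- k 6 , 2 , 5) ∷ (k 2 , 1 , 5) ∷ (- k 62 , 5 , 6)
  ∷ (k 62 , 6 , 6) ∷ (- k 180 , 6 , 5) ∷ (k 18 , 5 , 7) ∷ (- k 12 , 6 , 7) ∷ (- k 2 , 5 , 8)
  ∷ (1ℚ , 6 , 8) ∷ (k 248 , 5 , 2) ∷ (k 248 , 6 , 2) ∷ (- k 96 , 6 , 1) ∷ (k 321 , 6 , 4)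
  ∷ (- k 180 , 5 , 3) ∷ (- k 144 , 5 , 1) ∷ (- k 360 , 6 , 3) ∷ (1ℚ , 4 , 8) ∷ (k 8 , 4 , 6)
  ∷ (- k 6 , 4 , 7) ∷ (k 18 , 4 , 5) ∷ (k 7 , 3 , 6) ∷ (k 90 , 5 , 5) ∷ (- k 14 , 3 , 5)
  ∷ (- 1ℚ , 3 , 7) ∷ (k 17 , 2 , 4) ∷ (k 28 , 3 , 3) ∷ (- k 28 , 3 , 2) ∷ (- k 4 , 1 , 3)
  ∷ (k 8 , 3 , 1) ∷ (- k 57 , 4 , 4) ∷ (k 36 , 4 , 3) ∷ (k 32 , 4 , 2) ∷ (- k 12 , 2 , 3)
  ∷ (- k 48 , 4 , 1) ∷ (- 1ℚ , 0 , 4) ∷ (k 16 , 4 , 0) ∷ []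

module _ {b : ℚ} (c : ℚ) (b≡0 : b ≡ 0ℚ) where

  ½b≡0 : ½ * b ≡ 0ℚ
  ½b≡0 = trans (cong (½ *_) b≡0) (*-zeroʳ ½)

  E11≡0 : E11 b c ≡ 0ℚ
  E11≡0 = p≡0⇒p*q≡0 (cong -_ (p≡0⇒p*q≡0 b≡0))

  E01≡0 : E01 b c ≡ 0ℚ
  E01≡0 = p≡0⇒p*q≡0 (cong -_ (p≡0⇒p*q≡0 b≡0))

  E20≡0 : E20 b c ≡ 0ℚ
  E20≡0 = p≡0⇒p*q≡0 (p≡0⇒p*q≡0 (p≡0⇒p*q≡0 ½b≡0))

  E21≡0 : E21 b c ≡ 0ℚ
  E21≡0 = p≡0⇒p*q≡0 (p≡0⇒p*q≡0 (p≡0⇒p*q≡0 ½b≡0))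

  E03≡0 : E03 b c ≡ 0ℚ
  E03≡0 = p≡0⇒p*q≡0 (p≡0⇒p*q≡0 (p≡0⇒p*q≡0 (p≡0⇒p*q≡0 ½b≡0)))

  E30≡0 : E30 b c ≡ 0ℚ
  E30≡0 =
    p≡0⇒p*q≡0 (p≡0⇒p*q≡0 (p≡0⇒p*q≡0 (p≡0⇒p*q≡0 (p≡0⇒p*q≡0 (p≡0⇒p*q≡0
      (trans (cong (c *_) (p≡0⇒p*q≡0 b≡0)) (*-zeroʳ c)))))))

module AtB≡0 (c : ℚ) (c≢0 : c ≢ 0ℚ) where

  c²≢0 : c * c ≢ 0ℚ
  c²≢0 = *-≢0 c≢0 c≢0

  D≡c : D 0ℚ c ≡ c
  D≡c = trans (sumMonomials-at-b≡0 c D-monomials)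
    (solve 1 (λ c → con 1ℚ :* c :^ 1 :+ con 0ℚ := c) refl c)

  Δ≡c² : Δ 0ℚ c ≡ c * c
  Δ≡c² = trans (sumMonomials-at-b≡0 c Δ-monomials)
    (solve 1 (λ c → con 1ℚ :* c :^ 2 :+ con 0ℚ := c :* c) refl c)

  N²≡c² : N₁ 0ℚ c ^ 2 * N₂ 0ℚ c ^ 2 ≡ c * c
  N²≡c² = solve 1 (λ c →
    let N₁ = con 0ℚ :* c :- con 1ℚ :- con 0ℚ
        N₂ = con 0ℚ :* c :- c :- con (k 2) :* con 0ℚ
    in N₁ :^ 2 :* N₂ :^ 2 := c :* c) refl c

  E10≡1 : E10 0ℚ c ≡ 1ℚ
  E10≡1 = begin
    E10 0ℚ c
      ≡⟨ cong₂ (λ s d → - s * inv d) (sumMonomials-at-b≡0 c E10-monomials) D≡c ⟩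
    - (- 1ℚ * c ^ 1 + 0ℚ) * inv c
      ≡⟨ solve 2 (λ c m → :- (con (- 1ℚ) :* c :^ 1 :+ con 0ℚ) :* m := c :* m) refl c (inv c) ⟩
    c * inv c
      ≡⟨ *-inv c≢0 ⟩
    1ℚ
      ∎

  E02≡-1 : E02 0ℚ c ≡ - 1ℚ
  E02≡-1 = begin
    E02 0ℚ c
      ≡⟨ cong₂ (λ s n → ½ * s * inv n) (sumMonomials-at-b≡0 c E02-monomials) N²≡c² ⟩
    ½ * (- k 2 * c ^ 2 + 0ℚ) * inv (c * c)
      ≡⟨ solve 2 (λ c m → con ½ :* (con (- k 2) :* c :^ 2 :+ con 0ℚ) :* m
                      := :- (c :* c :* m)) refl c (inv (c * c)) ⟩
    - (c * c * inv (c * c))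
      ≡⟨ cong -_ (*-inv c²≢0) ⟩
    - 1ℚ
      ∎

  E12≡-1 : E12 0ℚ c ≡ - 1ℚ
  E12≡-1 = begin
    E12 0ℚ c
      ≡⟨ cong₂ (λ s (δ , n) → s * inv δ * inv n)
               (sumMonomials-at-b≡0 c E12-monomials) (cong₂ _,_ Δ≡c² N²≡c²) ⟩
    (- 1ℚ * c ^ 4 + 0ℚ) * inv (c * c) * inv (c * c)
      ≡⟨ solve 2 (λ c m → (con (- 1ℚ) :* c :^ 4 :+ con 0ℚ) :* m :* m
                      := :- ((c :* c :* m) :* (c :* c :* m))) refl c (inv (c * c)) ⟩
    - ((c * c * inv (c * c)) * (c * c * inv (c * c)))
      ≡⟨ cong (λ u → - (u * u)) (*-inv c²≢0) ⟩
    - 1ℚ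
      ∎

  P≡x³-x² : P 0ℚ c ≡ 0ℚ ∷ 0ℚ ∷ - 1ℚ ∷ 1ℚ ∷ []
  P≡x³-x² = begin
    P 0ℚ c
      ≡⟨ cong₂ (λ e₃₀ e₂₀ → - e₃₀ ∷ e₂₀ ∷ - E10 0ℚ c ∷ 1ℚ ∷ [])
               (E30≡0 c refl) (E20≡0 c refl) ⟩
    0ℚ ∷ 0ℚ ∷ - E10 0ℚ c ∷ 1ℚ ∷ []
      ≡⟨ cong (λ e₁₀ → 0ℚ ∷ 0ℚ ∷ - e₁₀ ∷ 1ℚ ∷ []) E10≡1 ⟩
    0ℚ ∷ 0ℚ ∷ - 1ℚ ∷ 1ℚ ∷ []
      ∎

  Q≡x³-x : Q 0ℚ c ≡ 0ℚ ∷ - 1ℚ ∷ 0ℚ ∷ 1ℚ ∷ []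
  Q≡x³-x = begin
    Q 0ℚ c
      ≡⟨ cong₂ (λ e₀₃ e₀₁ → - e₀₃ ∷ E02 0ℚ c ∷ - e₀₁ ∷ 1ℚ ∷ [])
               (E03≡0 c refl) (E01≡0 c refl) ⟩
    0ℚ ∷ E02 0ℚ c ∷ 0ℚ ∷ 1ℚ ∷ []
      ≡⟨ cong (λ e₀₂ → 0ℚ ∷ e₀₂ ∷ 0ℚ ∷ 1ℚ ∷ []) E02≡-1 ⟩
    0ℚ ∷ - 1ℚ ∷ 0ℚ ∷ 1ℚ ∷ []
      ∎

theorem2p1 : (b c : ℚ) → b ≡ 0ℚ → c ≢ 0ℚ →
    Reducible (P b c) × Reducible (Q b c)
    × (Σ ℤ λ x₁ → Σ ℤ λ x₂ → Σ ℤ λ x₃ → Σ ℤ λ d₁ → Σ ℤ λ d₂ → Σ ℤ λ d₃ →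
         RootsOf (P b c) (x₁ / 1) (x₂ / 1) (x₃ / 1)
         × RootsOf (Q b c) (d₁ / 1) (d₂ / 1) (d₃ / 1)
         × Auxiliary b c (x₁ / 1) (x₂ / 1) (x₃ / 1) (d₁ / 1) (d₂ / 1) (d₃ / 1)
         × ¬ AllPositive (x₁ / 1) (x₂ / 1) (x₃ / 1) (d₁ / 1) (d₂ / 1) (d₃ / 1))
    × ¬ SolvesProblem12 b c
theorem2p1 b c refl c≢0 =
    roots⇒reducible {P 0ℚ c} {0ℚ} {0ℚ} {1ℚ} P-roots
  , roots⇒reducible {Q 0ℚ c} {1ℚ} { - 1ℚ} {0ℚ} Q-roots
  , ( + 0 , + 0 , + 1 , + 1 , -[1+ 0 ] , + 0
    , P-roots , Q-roots , auxiliary , λ (x₁>0 , _) → <-irrefl refl x₁>0)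
  , λ (_ , _ , _ , _ , _ , _ , roots , _ , _ , x₁>0 , x₂>0 , x₃>0 , _) →
      eval-0≡0⇒¬positive-roots {f = P 0ℚ c} roots P[0]≡0 x₁>0 x₂>0 x₃>0
  where
  open AtB≡0 c c≢0

  P-roots : RootsOf (P 0ℚ c) 0ℚ 0ℚ 1ℚ
  P-roots = subst (λ f → RootsOf f 0ℚ 0ℚ 1ℚ) (sym P≡x³-x²) x³-x²-roots

  Q-roots : RootsOf (Q 0ℚ c) 1ℚ (- 1ℚ) 0ℚ
  Q-roots = subst (λ f → RootsOf f 1ℚ (- 1ℚ) 0ℚ) (sym Q≡x³-x) x³-x-roots

  auxiliary : Auxiliary 0ℚ c 0ℚ 0ℚ 1ℚ 1ℚ (- 1ℚ) 0ℚ
  auxiliary = sym (E21≡0 c refl) , sym (E11≡0 c refl) , sym E12≡-1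

  P[0]≡0 : eval (P 0ℚ c) 0ℚ ≡ 0ℚ
  P[0]≡0 = cong (λ f → eval f 0ℚ) P≡x³-x²
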